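{- Let $k\ge 2$, $n\ge 1$ and let $(a_{i,j})$ be an $\mathrm{SL}_k$-frieze pattern of height $n$ over $\mathbb{R}$ such that $D^\ell_{1,j}>0$ for all $\ell=1,\ldots,k-1$ and all $j=1,\ldots,n$. Then the pattern is generic (and thus tame and periodic).
   Context: An $\mathrm{SL}_k$-frieze pattern of height $n$ over a field $K$ is a family $(a_{i,j})$ of elements of $K$, indexed by $i\in\mathbb{Z}$ and $i-k\le j\le i+n+k-1$, such that $a_{i,j}=0$ for $i-k\le j\le i-2$ and for $i+n+1\le j\le i+n+k-1$, $a_{i,i-1}=a_{i,i+n}=1$, and (the entries $c_{i,j}:=a_{i,i+j-1}$, $1\le j\le n$, being otherwise arbitrary) for every $i\in\mathbb{Z}$ and every $j$ with $i-1\le j\le i+n$ the $k\times k$ matrix $(a_{r,s})_{i\le r\le i+k-1,\ j\le s\le j+k-1}$ has determinant $1$. For $\ell\ge1$ write $D^\ell_{i,j}=\det (a_{r,s})_{i\le r\le i+\ell-1,\ j\le s\le j+\ell-1}$ whenever all these entries are defined (e.g. $D^\ell_{1,j}$ for $1\le \ell\le k-1$, $1\le j\le n$ is the determinant of the block in rows $1,\dots,\ell$ and columns $j,\dots,j+\ell-1$). The pattern is generic if $D^{k-1}_{i,j}\ne 0$ for all $i\in\mathbb{Z}$ and all $j$ with $i\le j\le i+n-1$. It is tame if $D^{k+1}_{i,j}=0$ for all $i\in\mathbb{Z}$ and all $j$ with $i\le j\le i+n-1$. It is periodic if there is $m>0$ with $c_{i,j}=c_{i+m,j}$ for all $i\in\mathbb{Z}$,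 $1\le j\le n$. -}

module Defs where

open import Level using (0ℓ)
open import Data.Nat as ℕ using (ℕ; zero; suc; _∸_)
open import Data.Integer as ℤ using (ℤ; +_; _-_)
open import Data.Fin using (Fin; zero; suc; toℕ; punchIn)
open import Data.Product using (∃; _×_; _,_)
open import Data.Sum using (_⊎_)
open import Relation.Nullary using (¬_)
open import Relation.Binary.PropositionalEquality using (_≡_)
open import Algebra.Structures using (IsCommutativeRing)
open import Relation.Binary.Structures using (IsStrictTotalOrder)

record RealNumbers : Set₁ where
  infixl 7 _*_
  infixl 6 _+_
  infix 4 _<_ _≤_
  field
    Carrier : Set
    _+_ _*_ : Carrier → Carrier → Carrier
    -_ : Carrier → Carrier
    0# 1# : Carrier
    isCommutativeRing : IsCommutativeRing _≡_ _+_ _*_ -_ 0# 1#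
    0≢1 : ¬ (0# ≡ 1#)
    inverse : ∀ x → ¬ (x ≡ 0#) → ∃ λ y → x * y ≡ 1#
    _<_ : Carrier → Carrier → Set
    isStrictTotalOrder : IsStrictTotalOrder _≡_ _<_
    +-mono-< : ∀ {x y} z → x < y → x + z < y + z
    *-pos : ∀ {x y} → 0# < x → 0# < y → 0# < x * y

  _≤_ : Carrier → Carrier → Set
  x ≤ y = x < y ⊎ x ≡ y

  field
    lub : (P : Carrier → Set) → ∃ P → (∃ λ b → ∀ x → P x → x ≤ b) →
          ∃ λ s → (∀ x → P x → x ≤ s) × (∀ b → (∀ x → P x → x ≤ b) → s ≤ b)

module _ (ℝ : RealNumbers) where
  open RealNumbers ℝ

  altSum : ∀ {m} → (Fin m → Carrier) → Carrier
  altSum {zero} f = 0#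
  altSum {suc m} f = f zero + - altSum (λ j → f (suc j))

  det : (m : ℕ) → (Fin m → Fin m → Carrier) → Carrier
  det zero M = 1#
  det (suc m) M = altSum (λ j → M zero j * det m (λ r c → M (suc r) (punchIn j c)))

  D : (ℤ → ℤ → Carrier) → ℕ → ℤ → ℤ → Carrier
  D a ℓ i j = det ℓ (λ r c → a (i ℤ.+ + toℕ r) (j ℤ.+ + toℕ c))

  -- SL_k-frieze pattern of height n; a is given as a total function on ℤ×ℤ,
  -- only the entries with i-k ≤ j ≤ i+n+k-1 are constrained / ever used.
  record IsFrieze (k n : ℕ) (a : ℤ → ℤ → Carrier) : Set where
    field
      zeros-left  : ∀ i j → i - + k ℤ.≤ j → j ℤ.≤ i - + 2 → a i j ≡ 0#
      zeros-right : ∀ i j → i ℤ.+ + n ℤ.+ + 1 ℤ.≤ j → j ℤ.≤ i ℤ.+ + n ℤ.+ + k - + 1 → a i j ≡ 0#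
      ones-left   : ∀ i → a i (i - + 1) ≡ 1#
      ones-right  : ∀ i → a i (i ℤ.+ + n) ≡ 1#
      det-one     : ∀ i j → i - + 1 ℤ.≤ j → j ℤ.≤ i ℤ.+ + n → D a k i j ≡ 1#

  IsGeneric : (k n : ℕ) → (ℤ → ℤ → Carrier) → Set
  IsGeneric k n a = ∀ i j → i ℤ.≤ j → j ℤ.≤ i ℤ.+ + n - + 1 → ¬ (D a (k ∸ 1) i j ≡ 0#)

{-# OPTIONS --safe #-}
module Submission where

open import Defs
open import Data.Nat using (ℕ; _≤_; _∸_)
open import Data.Integer using (ℤ; +_) renaming (_≤_ to _≤ℤ_)

open import Level using (0ℓ)
open import Algebra.Bundles using (CommutativeRing)
open import Algebra.Solver.Ring.AlmostCommutativeRing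
  using (_-Raw-AlmostCommutative⟶_; fromCommutativeRing)
open import Data.Empty using (⊥-elim)
open import Data.Fin as Fin using (Fin; zero; suc; punchIn; inject₁; fromℕ; toℕ)
open import Data.Integer as ℤ using (-[1+_]; _⊖_; 0ℤ; 1ℤ)
import Data.Integer.Properties as ℤ
open import Data.Integer.Tactic.RingSolver using (solve-∀)
open import Data.Fin.Properties using (toℕ-inject₁; toℕ<n)
open import Data.Maybe using (Maybe; just; nothing)
open import Data.Nat as ℕ using (zero; suc)
import Data.Nat.Properties as ℕ
open import Data.Product using (_,_; ∃; _×_)
open import Data.Sum using (_⊎_; inj₁; inj₂)
open import Function using (_∘_; id)
open import Data.Vec.Functional using (_∷_; tail; init; map; transpose; removeAt)
open import Relation.Binary.Definitions using (tri<; tri≈; tri>)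
open import Relation.Binary.PropositionalEquality as ≡
  using (_≡_; _≢_; cong; cong₂; subst; subst₂)
open import Relation.Nullary using (yes; no)

-- The Desnanot–Jacobi identity
--   D^{ℓ+1}_{i+1,j+1} D^{ℓ+1}_{i,j} = D^{ℓ+2}_{i,j} D^ℓ_{i+1,j+1} + D^{ℓ+1}_{i+1,j} D^{ℓ+1}_{i,j+1}
-- writes the product of two minors as a sum of products of four neighbouring ones.  In each row i the
-- minors D^ℓ_{i,j} with ℓ = 0, ℓ = k, j = i - 1 or j = i + n all equal 1, so positivity of one row of
-- minors propagates to the next row (by induction on ℓ and j) and to the previous one (by induction on
-- k - ℓ and i + n - j).  Starting from the first row, every D^{k-1}_{i,j} is positive, hence nonzero.
--
-- The identity itself is proved for the Laplace-expansion determinant, assuming the central minor c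
-- is nonzero: the corresponding combination Φ(x) of determinants with x in place of the first row is
-- linear in x and vanishes on the middle rows and on the first and last unit vectors, while by
-- Cramer's rule c·x lies in their span.

-- Algebra.Solver.Ring.Simple would use the carrier as coefficients, whose equality does not compute;
-- integer coefficients make identities such as x - x = 0 normalise.
module IntegerCoefficientSolver {c ℓ} (R : CommutativeRing c ℓ) where
  open CommutativeRing R
  open import Algebra.Properties.Ring ring
    using (-‿involutive; -‿distribˡ-*; -‿distribʳ-*; -0#≈0#; -‿+-comm)
  open import Algebra.Properties.Semiring.Mult.TCOptimised semiring
    using (1+×; ×-homo-+; ×1-homo-*) renaming (_×_ to _×′_)
  open import Relation.Binary.Reasoning.Setoid setoid

  fromℤ : ℤ → Carrier
  fromℤ (+ n)      = n ×′ 1#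
  fromℤ -[1+ n ]   = - (suc n ×′ 1#)

  private
    [1+x]-[1+y]≈x-y : ∀ x y → (1# + x) - (1# + y) ≈ x - y
    [1+x]-[1+y]≈x-y x y = begin
      (1# + x) + - (1# + y)    ≈⟨ +-cong (+-comm x 1#) (-‿+-comm 1# y) ⟨
      (x + 1#) + (- 1# + - y)  ≈⟨ +-assoc x 1# _ ⟩
      x + (1# + (- 1# + - y))  ≈⟨ +-congˡ (+-assoc 1# (- 1#) (- y)) ⟨
      x + ((1# + - 1#) + - y)  ≈⟨ +-congˡ (+-congʳ (-‿inverseʳ 1#)) ⟩
      x + (0# + - y)           ≈⟨ +-congˡ (+-identityˡ (- y)) ⟩
      x + - y                  ∎

    ⊖-homo : ∀ m n → fromℤ (m ⊖ n) ≈ m ×′ 1# - n ×′ 1#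
    ⊖-homo m       zero    = sym (trans (+-congˡ -0#≈0#) (+-identityʳ _))
    ⊖-homo zero    (suc n) = sym (+-identityˡ _)
    ⊖-homo (suc m) (suc n) = begin
      fromℤ (suc m ⊖ suc n)          ≡⟨ cong fromℤ (ℤ.[1+m]⊖[1+n]≡m⊖n m n) ⟩
      fromℤ (m ⊖ n)                  ≈⟨ ⊖-homo m n ⟩
      m ×′ 1# - n ×′ 1#                ≈⟨ [1+x]-[1+y]≈x-y _ _ ⟨
      (1# + m ×′ 1#) - (1# + n ×′ 1#)  ≈⟨ +-cong (1+× m 1#) (-‿cong (1+× n 1#)) ⟨
      suc m ×′ 1# - suc n ×′ 1#        ∎

    +-homo : ∀ i j → fromℤ (i ℤ.+ j) ≈ fromℤ i + fromℤ j
    +-homo (+ m)    (+ n)    = ×-homo-+ 1# m n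
    +-homo (+ m)    -[1+ n ] = ⊖-homo m (suc n)
    +-homo -[1+ m ] (+ n)    = trans (⊖-homo n (suc m)) (+-comm _ _)
    +-homo -[1+ m ] -[1+ n ] = begin
      - (suc (suc (m ℕ.+ n)) ×′ 1#)     ≡⟨ cong (λ k → - (suc k ×′ 1#)) (ℕ.+-suc m n) ⟨
      - ((suc m ℕ.+ suc n) ×′ 1#)       ≈⟨ -‿cong (×-homo-+ 1# (suc m) (suc n)) ⟩
      - (suc m ×′ 1# + suc n ×′ 1#)      ≈⟨ -‿+-comm _ _ ⟨
      - (suc m ×′ 1#) + - (suc n ×′ 1#)  ∎

    -‿homo : ∀ i → fromℤ (ℤ.- i) ≈ - fromℤ i
    -‿homo (+ zero)  = sym -0#≈0#
    -‿homo (+ suc n) = refl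
    -‿homo -[1+ n ]  = sym (-‿involutive _)

    +*-homo : ∀ m j → fromℤ (+ m ℤ.* j) ≈ fromℤ (+ m) * fromℤ j
    +*-homo m (+ n) = begin
      fromℤ (+ m ℤ.* + n)                ≡⟨ cong fromℤ (ℤ.pos-* m n) ⟨
      (m ℕ.* n) ×′ 1#                     ≈⟨ ×1-homo-* m n ⟩
      fromℤ (+ m) * fromℤ (+ n)          ∎
    +*-homo m -[1+ n ] = begin
      fromℤ (+ m ℤ.* ℤ.- + suc n)        ≡⟨ cong fromℤ (ℤ.neg-distribʳ-* (+ m) (+ suc n)) ⟨
      fromℤ (ℤ.- (+ m ℤ.* + suc n))      ≈⟨ -‿homo (+ m ℤ.* + suc n) ⟩
      - fromℤ (+ m ℤ.* + suc n)          ≈⟨ -‿cong (+*-homo m (+ suc n)) ⟩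
      - (fromℤ (+ m) * fromℤ (+ suc n))  ≈⟨ -‿distribʳ-* _ _ ⟩
      fromℤ (+ m) * fromℤ -[1+ n ]       ∎

    *-homo : ∀ i j → fromℤ (i ℤ.* j) ≈ fromℤ i * fromℤ j
    *-homo (+ m)    j = +*-homo m j
    *-homo -[1+ m ] j = begin
      fromℤ (ℤ.- + suc m ℤ.* j)          ≡⟨ cong fromℤ (ℤ.neg-distribˡ-* (+ suc m) j) ⟨
      fromℤ (ℤ.- (+ suc m ℤ.* j))        ≈⟨ -‿homo (+ suc m ℤ.* j) ⟩
      - fromℤ (+ suc m ℤ.* j)            ≈⟨ -‿cong (+*-homo (suc m) j) ⟩
      - (fromℤ (+ suc m) * fromℤ j)      ≈⟨ -‿distribˡ-* _ _ ⟩
      fromℤ -[1+ m ] * fromℤ j           ∎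

  fromℤ-homomorphism : ℤ.+-*-rawRing -Raw-AlmostCommutative⟶ fromCommutativeRing R
  fromℤ-homomorphism = record
    { ⟦_⟧ = fromℤ ; +-homo = +-homo ; *-homo = *-homo ; -‿homo = -‿homo
    ; 0-homo = refl ; 1-homo = refl
    }

  fromℤ-≈-if-≡ : ∀ i j → Maybe (fromℤ i ≈ fromℤ j)
  fromℤ-≈-if-≡ i j with i ℤ.≟ j
  ... | yes ≡.refl = just refl
  ... | no _       = nothing

  open import Algebra.Solver.Ring ℤ.+-*-rawRing (fromCommutativeRing R)
    fromℤ-homomorphism fromℤ-≈-if-≡ public
    using (solve; _:+_; _:*_; :-_; _:=_; con)

module OrderedField (ℝ : RealNumbers) where
  open RealNumbers ℝ
  open import Relation.Binary.Structures using (IsStrictTotalOrder)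
  open IsStrictTotalOrder isStrictTotalOrder using (compare; irrefl; asym) renaming (trans to <-trans)

  commutativeRing : CommutativeRing 0ℓ 0ℓ
  commutativeRing = record { isCommutativeRing = isCommutativeRing }

  open CommutativeRing commutativeRing public
    using (+-identityˡ; +-identityʳ; *-identityˡ; -‿inverseʳ; zeroˡ; zeroʳ; *-comm; *-assoc; distribˡ; distribʳ)
  open import Algebra.Properties.Ring (CommutativeRing.ring commutativeRing) public
    using (-‿involutive; -‿distribˡ-*; -‿distribʳ-*; -0#≈0#; -1*x≈-x; -‿+-comm)
  open import Algebra.Properties.CommutativeSemigroup (CommutativeRing.+-commutativeSemigroup commutativeRing)
    public using () renaming (interchange to +-interchange)
  open import Algebra.Properties.CommutativeSemigroup (CommutativeRing.*-commutativeSemigroup commutativeRing)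
    public using () renaming (x∙yz≈y∙xz to x*yz≡y*xz)
  open IntegerCoefficientSolver commutativeRing public
  open ≡.≡-Reasoning

  positive⇒≢0 : ∀ {x} → 0# < x → x ≢ 0#
  positive⇒≢0 0<x x≡0 = irrefl ≡.refl (subst (0# <_) x≡0 0<x)

  x<0⇒0<-x : ∀ {x} → x < 0# → 0# < - x
  x<0⇒0<-x {x} x<0 = subst₂ _<_ (-‿inverseʳ x) (+-identityˡ (- x)) (+-mono-< (- x) x<0)

  0<x⇒-x<0 : ∀ {x} → 0# < x → - x < 0#
  0<x⇒-x<0 {x} 0<x = subst₂ _<_ (+-identityˡ (- x)) (-‿inverseʳ x) (+-mono-< (- x) 0<x)

  0<1 : 0# < 1#
  0<1 with compare 1# 0#
  ... | tri< 1<0 _ _ = ⊥-elim (asym 1<0 (subst (0# <_) -1*-1≡1 (*-pos 0<-1 0<-1)))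
    where
    0<-1 : 0# < - 1#
    0<-1 = x<0⇒0<-x 1<0
    -1*-1≡1 : - 1# * - 1# ≡ 1#
    -1*-1≡1 = solve 0 (:- con 1ℤ :* :- con 1ℤ := con 1ℤ) ≡.refl
  ... | tri≈ _ 1≡0 _ = ⊥-elim (0≢1 (≡.sym 1≡0))
  ... | tri> _ _ 0<1 = 0<1

  +-positive : ∀ {x y} → 0# < x → 0# < y → 0# < x + y
  +-positive {x} {y} 0<x 0<y =
    <-trans (subst (0# <_) (≡.sym (+-identityˡ y)) 0<y) (+-mono-< y 0<x)

  *-positive-cancelʳ : ∀ {x y} → 0# < y → 0# < x * y → 0# < x
  *-positive-cancelʳ {x} {y} 0<y 0<xy with compare x 0#
  ... | tri< x<0 _ _ = ⊥-elim (asym 0<xy (subst (_< 0#) (-‿involutive (x * y)) (0<x⇒-x<0 0<-xy)))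
    where
    0<-xy : 0# < - (x * y)
    0<-xy = subst (0# <_) (≡.sym (-‿distribˡ-* x y)) (*-pos (x<0⇒0<-x x<0) 0<y)
  ... | tri≈ _ x≡0 _ = ⊥-elim (irrefl (≡.sym (≡.trans (cong (_* y) x≡0) (zeroˡ y))) 0<xy)
  ... | tri> _ _ 0<x = 0<x

  *-positive-cancelˡ : ∀ {x y} → 0# < x → 0# < x * y → 0# < y
  *-positive-cancelˡ {x} {y} 0<x 0<xy = *-positive-cancelʳ 0<x (subst (0# <_) (*-comm x y) 0<xy)

  x≡-x⇒x≡0 : ∀ {x} → x ≡ - x → x ≡ 0#
  x≡-x⇒x≡0 {x} x≡-x with compare x 0#
  ... | tri< x<0 _ _ = ⊥-elim (asym x<0 (subst (0# <_) (≡.sym x≡-x) (x<0⇒0<-x x<0)))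
  ... | tri≈ _ x≡0 _ = x≡0
  ... | tri> _ _ 0<x = ⊥-elim (asym 0<x (subst (_< 0#) (≡.sym x≡-x) (0<x⇒-x<0 0<x)))

  x-y≡0⇒x≡y : ∀ {x y} → x + - y ≡ 0# → x ≡ y
  x-y≡0⇒x≡y {x} {y} x-y≡0 = begin
    x                ≡⟨ solve 2 (λ x y → x := (x :+ :- y) :+ y) ≡.refl x y ⟩
    (x + - y) + y    ≡⟨ cong (_+ y) x-y≡0 ⟩
    0# + y           ≡⟨ +-identityˡ y ⟩
    y                ∎

  x≡y-z⇒y≡x+z : ∀ {x y z} → x ≡ y + - z → y ≡ x + z
  x≡y-z⇒y≡x+z {x} {y} {z} x≡y-z = begin
    y                ≡⟨ solve 2 (λ y z → y := (y :+ :- z) :+ z) ≡.refl y z ⟩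
    (y + - z) + z    ≡⟨ cong (_+ z) x≡y-z ⟨
    x + z            ∎

  ≡1⇒positive : ∀ {x} → x ≡ 1# → 0# < x
  ≡1⇒positive x≡1 = subst (0# <_) (≡.sym x≡1) 0<1

  *-nonzero-cancelˡ : ∀ {c y} → c ≢ 0# → c * y ≡ 0# → y ≡ 0#
  *-nonzero-cancelˡ {c} {y} c≢0 cy≡0 with inverse c c≢0
  ... | c⁻¹ , cc⁻¹≡1 = begin
    y                ≡⟨ *-identityˡ y ⟨
    1# * y           ≡⟨ cong (_* y) cc⁻¹≡1 ⟨
    (c * c⁻¹) * y    ≡⟨ ≡.trans (*-assoc c c⁻¹ y) (x*yz≡y*xz c c⁻¹ y) ⟩
    c⁻¹ * (c * y)    ≡⟨ cong (c⁻¹ *_) cy≡0 ⟩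
    c⁻¹ * 0#         ≡⟨ zeroʳ c⁻¹ ⟩
    0#               ∎

module Determinants (ℝ : RealNumbers) where
  open RealNumbers ℝ
  open OrderedField ℝ
  open ≡.≡-Reasoning

  Matrix : ℕ → Set
  Matrix m = Fin m → Fin m → Carrier

  Σ± : ∀ {m} → (Fin m → Carrier) → Carrier
  Σ± = altSum ℝ

  minor : ∀ {m} → Matrix (suc m) → Fin (suc m) → Matrix m
  minor M j r c = M (suc r) (punchIn j c)

  Σ±-cong : ∀ {m} {f g : Fin m → Carrier} → (∀ j → f j ≡ g j) → Σ± f ≡ Σ± g
  Σ±-cong {zero}  f≗g = ≡.refl
  Σ±-cong {suc m} f≗g = cong₂ (λ x y → x + - y) (f≗g zero) (Σ±-cong (f≗g ∘ suc))

  Σ±-zero : ∀ {m} {f : Fin m → Carrier} → (∀ j → f j ≡ 0#) → Σ± f ≡ 0#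
  Σ±-zero {zero}  f≗0 = ≡.refl
  Σ±-zero {suc m} {f} f≗0 = begin
    Σ± f              ≡⟨ cong₂ (λ x y → x + - y) (f≗0 zero) (Σ±-zero (f≗0 ∘ suc)) ⟩
    0# + - 0#         ≡⟨ ≡.trans (+-identityˡ (- 0#)) -0#≈0# ⟩
    0#                ∎

  Σ±-head : ∀ {m} (f : Fin (suc m) → Carrier) → (∀ j → f (suc j) ≡ 0#) → Σ± f ≡ f zero
  Σ±-head f tail≗0 = begin
    f zero + - Σ± (f ∘ suc)  ≡⟨ cong (λ s → f zero + - s) (Σ±-zero tail≗0) ⟩
    f zero + - 0#            ≡⟨ solve 1 (λ x → x :+ :- con 0ℤ := x) ≡.refl (f zero) ⟩
    f zero                   ∎

  Σ±-+ : ∀ {m} (f g : Fin m → Carrier) → Σ± (λ j → f j + g j) ≡ Σ± f + Σ± g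
  Σ±-+ {zero}  f g = ≡.sym (+-identityʳ 0#)
  Σ±-+ {suc m} f g = begin
    (f zero + g zero) + - Σ± (λ j → f (suc j) + g (suc j))
      ≡⟨ cong (λ s → (f zero + g zero) + - s) (Σ±-+ (f ∘ suc) (g ∘ suc)) ⟩
    (f zero + g zero) + - (Σ± (f ∘ suc) + Σ± (g ∘ suc))
      ≡⟨ solve 4 (λ a b x y → (a :+ b) :+ :- (x :+ y) := (a :+ :- x) :+ (b :+ :- y)) ≡.refl
           (f zero) (g zero) (Σ± (f ∘ suc)) (Σ± (g ∘ suc)) ⟩
    Σ± f + Σ± g ∎

  *-distribˡ-Σ± : ∀ {m} x (f : Fin m → Carrier) → x * Σ± f ≡ Σ± (λ j → x * f j)
  *-distribˡ-Σ± {zero}  x f = zeroʳ x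
  *-distribˡ-Σ± {suc m} x f = begin
    x * (f zero + - Σ± (f ∘ suc))          ≡⟨ distribˡ x (f zero) (- Σ± (f ∘ suc)) ⟩
    x * f zero + x * - Σ± (f ∘ suc)        ≡⟨ cong (λ t → x * f zero + t) (-‿distribʳ-* x (Σ± (f ∘ suc))) ⟨
    x * f zero + - (x * Σ± (f ∘ suc))      ≡⟨ cong (λ s → x * f zero + - s) (*-distribˡ-Σ± x (f ∘ suc)) ⟩
    Σ± (λ j → x * f j)                     ∎

  -‿distrib-Σ± : ∀ {m} (f : Fin m → Carrier) → - Σ± f ≡ Σ± (λ j → - f j)
  -‿distrib-Σ± {zero}  f = -0#≈0#
  -‿distrib-Σ± {suc m} f = begin
    - (f zero + - Σ± (f ∘ suc))        ≡⟨ -‿+-comm (f zero) (- Σ± (f ∘ suc)) ⟨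
    - f zero + - (- Σ± (f ∘ suc))      ≡⟨ cong (λ s → - f zero + - s) (-‿distrib-Σ± (f ∘ suc)) ⟩
    Σ± (λ j → - f j)                   ∎

  Σ±-comm : ∀ {m n} (F : Fin m → Fin n → Carrier) →
            Σ± (λ i → Σ± (F i)) ≡ Σ± (λ j → Σ± (λ i → F i j))
  Σ±-comm {zero} {n} F = ≡.sym (Σ±-zero {n} (λ _ → ≡.refl))
  Σ±-comm {suc m} F = begin
    Σ± (F zero) + - Σ± (λ i → Σ± (F (suc i)))
      ≡⟨ cong (λ s → Σ± (F zero) + - s) (Σ±-comm (F ∘ suc)) ⟩
    Σ± (F zero) + - Σ± (λ j → Σ± (λ i → F (suc i) j))
      ≡⟨ cong (λ s → Σ± (F zero) + s) (-‿distrib-Σ± (λ j → Σ± (λ i → F (suc i) j))) ⟩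
    Σ± (F zero) + Σ± (λ j → - Σ± (λ i → F (suc i) j))
      ≡⟨ Σ±-+ (F zero) (λ j → - Σ± (λ i → F (suc i) j)) ⟨
    Σ± (λ j → Σ± (λ i → F i j)) ∎

  e-first : ∀ {m} → Fin (suc m) → Carrier
  e-first zero    = 1#
  e-first (suc _) = 0#

  e-last : ∀ {m} → Fin (suc m) → Carrier
  e-last {zero}  zero    = 1#
  e-last {suc m} zero    = 0#
  e-last {suc m} (suc j) = e-last j

  e-last-inject₁ : ∀ {m} (j : Fin m) → e-last (inject₁ j) ≡ 0#
  e-last-inject₁ {suc m} zero    = ≡.refl
  e-last-inject₁ {suc m} (suc j) = e-last-inject₁ j

  e-last-fromℕ : ∀ m → e-last (fromℕ m) ≡ 1#
  e-last-fromℕ zero    = ≡.refl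
  e-last-fromℕ (suc m) = e-last-fromℕ m

  Σ±-e-last : ∀ {m} (f : Fin (suc m) → Carrier) → Σ± (λ j → e-last j * f j) ≡ Σ± (e-last {m}) * f (fromℕ m)
  Σ±-e-last {zero}  f = solve 1 (λ x → con 1ℤ :* x :+ :- con 0ℤ := (con 1ℤ :+ :- con 0ℤ) :* x) ≡.refl (f zero)
  Σ±-e-last {suc m} f = begin
    0# * f zero + - Σ± (λ j → e-last j * f (suc j))  ≡⟨ cong (λ s → 0# * f zero + - s) (Σ±-e-last (f ∘ suc)) ⟩
    0# * f zero + - (σ * f (fromℕ (suc m)))
      ≡⟨ solve 3 (λ a s x → con 0ℤ :* a :+ :- (s :* x) := (con 0ℤ :+ :- s) :* x) ≡.refl (f zero) σ (f (fromℕ (suc m))) ⟩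
    Σ± (e-last {suc m}) * f (fromℕ (suc m))          ∎
    where σ = Σ± (e-last {m})

  Σ±-*-comm : ∀ {m n} (a : Fin m → Carrier) (b : Fin n → Carrier) (H : Fin m → Fin n → Carrier) →
              Σ± (λ j → a j * Σ± (λ i → b i * H j i)) ≡ Σ± (λ i → b i * Σ± (λ j → a j * H j i))
  Σ±-*-comm a b H = begin
    Σ± (λ j → a j * Σ± (λ i → b i * H j i))    ≡⟨ Σ±-cong (λ j → *-distribˡ-Σ± (a j) (λ i → b i * H j i)) ⟩
    Σ± (λ j → Σ± (λ i → a j * (b i * H j i)))  ≡⟨ Σ±-comm (λ j i → a j * (b i * H j i)) ⟩
    Σ± (λ i → Σ± (λ j → a j * (b i * H j i)))  ≡⟨ Σ±-cong (λ i → Σ±-cong (λ j → x*yz≡y*xz (a j) (b i) (H j i))) ⟩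
    Σ± (λ i → Σ± (λ j → b i * (a j * H j i)))  ≡⟨ Σ±-cong (λ i → *-distribˡ-Σ± (b i) (λ j → a j * H j i)) ⟨
    Σ± (λ i → b i * Σ± (λ j → a j * H j i))    ∎

  det-cong : ∀ m {M N : Matrix m} → (∀ r c → M r c ≡ N r c) → det ℝ m M ≡ det ℝ m N
  det-cong zero    _   = ≡.refl
  det-cong (suc m) M≗N =
    Σ±-cong (λ j → cong₂ _*_ (M≗N zero j) (det-cong m (λ r c → M≗N (suc r) (punchIn j c))))

  det-transpose : ∀ m (M : Matrix m) → det ℝ m (transpose M) ≡ det ℝ m M
  det-transpose zero          M = ≡.refl
  det-transpose (suc zero)    M = ≡.refl
  det-transpose (suc (suc m)) M = begin
    det ℝ (suc (suc m)) (transpose M)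
      ≡⟨ expand (det-transpose (suc m)) (det-transpose m) (transpose M) ⟩
    M zero zero * det ℝ (suc m) (minor (transpose M) zero)
      + - Σ± (λ j → M (suc j) zero * Σ± (λ i → M zero (suc i) * det ℝ m (minor₂ (transpose M) i j)))
      ≡⟨ cong₂ (λ x s → M zero zero * x + - s) (det-transpose (suc m) (minor M zero))
           (Σ±-cong (λ j → cong (M (suc j) zero *_) (Σ±-cong (λ i → cong (M zero (suc i) *_)
             (det-transpose m (minor₂ M j i)))))) ⟩
    M zero zero * det ℝ (suc m) (minor M zero)
      + - Σ± (λ j → M (suc j) zero * Σ± (λ i → M zero (suc i) * det ℝ m (minor₂ M j i)))
      ≡⟨ cong (λ s → M zero zero * det ℝ (suc m) (minor M zero) + - s)
           (Σ±-*-comm (λ j → M (suc j) zero) (λ i → M zero (suc i)) (minor₂-det M)) ⟩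
    M zero zero * det ℝ (suc m) (minor M zero)
      + - Σ± (λ i → M zero (suc i) * Σ± (λ j → M (suc j) zero * det ℝ m (minor₂ M j i)))
      ≡⟨ expand (det-transpose (suc m)) (det-transpose m) M ⟨
    det ℝ (suc (suc m)) M ∎
    where
    minor₂ : Matrix (suc (suc m)) → Fin (suc m) → Fin (suc m) → Matrix m
    minor₂ N i j r c = N (suc (punchIn i r)) (suc (punchIn j c))

    minor₂-det : Matrix (suc (suc m)) → Fin (suc m) → Fin (suc m) → Carrier
    minor₂-det N i j = det ℝ m (minor₂ N i j)

    expand : (∀ X → det ℝ (suc m) (transpose X) ≡ det ℝ (suc m) X) →
             (∀ X → det ℝ m (transpose X) ≡ det ℝ m X) →
             ∀ N → det ℝ (suc (suc m)) N ≡
      N zero zero * det ℝ (suc m) (minor N zero)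
        + - Σ± (λ j → N zero (suc j) * Σ± (λ i → N (suc i) zero * det ℝ m (minor₂ N i j)))
    expand transpose₁ transpose₀ N = cong (λ s → N zero zero * det ℝ (suc m) (minor N zero) + - s)
      (Σ±-cong (λ j → cong (N zero (suc j) *_) (begin
        det ℝ (suc m) (minor N (suc j))               ≡⟨ transpose₁ (minor N (suc j)) ⟨
        det ℝ (suc m) (transpose (minor N (suc j)))   ≡⟨ Σ±-cong (λ i → cong (N (suc i) zero *_)
                                                           (transpose₀ (minor₂ N i j))) ⟩
        Σ± (λ i → N (suc i) zero * det ℝ m (minor₂ N i j)) ∎)))

  swap₀₁ : ∀ {m} → Fin (suc (suc m)) → Fin (suc (suc m))
  swap₀₁ zero          = suc zero
  swap₀₁ (suc zero)    = zero
  swap₀₁ (suc (suc j)) = suc (suc j)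

  expansionTail : ∀ {m} → Matrix (suc (suc m)) → Carrier
  expansionTail {m} N = Σ± (λ j → N zero (suc (suc j)) * det ℝ (suc m) (minor N (suc (suc j))))

  det-swap-columns₀₁ : ∀ m (M : Matrix (suc (suc m))) →
                       det ℝ (suc (suc m)) (λ r c → M r (swap₀₁ c)) ≡ - det ℝ (suc (suc m)) M
  expansionTail-swap-columns₀₁ : ∀ m (M : Matrix (suc (suc m))) →
                                 expansionTail (λ r c → M r (swap₀₁ c)) ≡ - expansionTail M

  det-swap-columns₀₁ m M = begin
    b * det ℝ (suc m) (minor M′ zero) + - (a * det ℝ (suc m) (minor M′ (suc zero)) + - expansionTail M′)
      ≡⟨ cong₂ (λ x s → b * x + - s) (det-cong (suc m) minor-zero)
           (cong₂ (λ y t → a * y + - t) (det-cong (suc m) minor-one) (expansionTail-swap-columns₀₁ m M)) ⟩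
    b * X + - (a * Y + - - expansionTail M)
      ≡⟨ solve 5 (λ a b X Y t → b :* X :+ :- (a :* Y :+ :- (:- t)) := :- (a :* Y :+ :- (b :* X :+ :- t)))
           ≡.refl a b X Y (expansionTail M) ⟩
    - det ℝ (suc (suc m)) M ∎
    where
    M′ : Matrix (suc (suc m))
    M′ r c = M r (swap₀₁ c)
    a b X Y : Carrier
    a = M zero zero
    b = M zero (suc zero)
    X = det ℝ (suc m) (minor M (suc zero))
    Y = det ℝ (suc m) (minor M zero)
    minor-zero : ∀ r c → minor M′ zero r c ≡ minor M (suc zero) r c
    minor-zero r zero    = ≡.refl
    minor-zero r (suc c) = ≡.refl
    minor-one : ∀ r c → minor M′ (suc zero) r c ≡ minor M zero r c
    minor-one r zero    = ≡.refl
    minor-one r (suc c) = ≡.refl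

  expansionTail-swap-columns₀₁ zero    M = ≡.sym -0#≈0#
  expansionTail-swap-columns₀₁ (suc m) M = begin
    Σ± (λ j → M zero (suc (suc j)) * det ℝ (suc (suc m)) (minor M′ (suc (suc j))))
      ≡⟨ Σ±-cong (λ j → ≡.trans (cong (M zero (suc (suc j)) *_) (swapped-minor j)) (≡.sym (-‿distribʳ-* _ _))) ⟩
    Σ± (λ j → - (M zero (suc (suc j)) * det ℝ (suc (suc m)) (minor M (suc (suc j)))))
      ≡⟨ -‿distrib-Σ± (λ j → M zero (suc (suc j)) * det ℝ (suc (suc m)) (minor M (suc (suc j)))) ⟨
    - expansionTail M ∎
    where
    M′ : Matrix (suc (suc (suc m)))
    M′ r c = M r (swap₀₁ c)
    swap-commutes : ∀ j c → swap₀₁ (punchIn (suc (suc j)) c) ≡ punchIn (suc (suc j)) (swap₀₁ c)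
    swap-commutes j zero          = ≡.refl
    swap-commutes j (suc zero)    = ≡.refl
    swap-commutes j (suc (suc c)) = ≡.refl
    swapped-minor : ∀ j → det ℝ (suc (suc m)) (minor M′ (suc (suc j))) ≡
                          - det ℝ (suc (suc m)) (minor M (suc (suc j)))
    swapped-minor j = ≡.trans (det-cong (suc (suc m)) (λ r c → cong (M (suc r)) (swap-commutes j c)))
                              (det-swap-columns₀₁ m (minor M (suc (suc j))))

  det-swap-rows₀₁ : ∀ m (M : Matrix (suc (suc m))) →
                    det ℝ (suc (suc m)) (M ∘ swap₀₁) ≡ - det ℝ (suc (suc m)) M
  det-swap-rows₀₁ m M = begin
    det ℝ (suc (suc m)) (M ∘ swap₀₁)                       ≡⟨ det-transpose (suc (suc m)) (M ∘ swap₀₁) ⟨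
    det ℝ (suc (suc m)) (λ r c → transpose M r (swap₀₁ c)) ≡⟨ det-swap-columns₀₁ m (transpose M) ⟩
    - det ℝ (suc (suc m)) (transpose M)                    ≡⟨ cong -_ (det-transpose (suc (suc m)) M) ⟩
    - det ℝ (suc (suc m)) M                                ∎

  det-equal-rows : ∀ m (t : Fin m) (M : Matrix (suc m)) → (∀ c → M (suc t) c ≡ M zero c) → det ℝ (suc m) M ≡ 0#
  det-equal-rows (suc m) zero M row₁≗row₀ = x≡-x⇒x≡0 (begin
    det ℝ (suc (suc m)) M             ≡⟨ det-cong (suc (suc m)) swap-invariant ⟨
    det ℝ (suc (suc m)) (M ∘ swap₀₁)  ≡⟨ det-swap-rows₀₁ m M ⟩
    - det ℝ (suc (suc m)) M           ∎)
    where
    swap-invariant : ∀ r c → M (swap₀₁ r) c ≡ M r c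
    swap-invariant zero          c = row₁≗row₀ c
    swap-invariant (suc zero)    c = ≡.sym (row₁≗row₀ c)
    swap-invariant (suc (suc r)) c = ≡.refl
  -- After swapping rows zero and one, every minor along the first row has two equal rows.
  det-equal-rows (suc (suc m)) (suc t) M row[2+t]≗row₀ = begin
    det ℝ (suc (suc (suc m))) M               ≡⟨ -‿involutive _ ⟨
    - - det ℝ (suc (suc (suc m))) M           ≡⟨ cong -_ (det-swap-rows₀₁ (suc m) M) ⟨
    - det ℝ (suc (suc (suc m))) (M ∘ swap₀₁)  ≡⟨ cong -_ (Σ±-zero (λ j → ≡.trans (cong (M (suc zero) j *_)
                                                    (det-equal-rows (suc m) t (minor (M ∘ swap₀₁) j)
                                                      (λ c → row[2+t]≗row₀ (punchIn j c))))
                                                    (zeroʳ _))) ⟩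
    - 0#                                      ≡⟨ -0#≈0# ⟩
    0#                                        ∎

  det-lower-unitriangular : ∀ m (M : Matrix m) → (∀ {r c} → r Fin.< c → M r c ≡ 0#) → (∀ r → M r r ≡ 1#) →
                            det ℝ m M ≡ 1#
  det-lower-unitriangular zero    M above diagonal = ≡.refl
  det-lower-unitriangular (suc m) M above diagonal = begin
    det ℝ (suc m) M
      ≡⟨ Σ±-head (λ j → M zero j * det ℝ m (minor M j))
           (λ j → ≡.trans (cong (_* det ℝ m (minor M (suc j))) (above {c = suc j} ℕ.z<s)) (zeroˡ _)) ⟩
    M zero zero * det ℝ m (minor M zero)
      ≡⟨ cong₂ _*_ (diagonal zero) (det-lower-unitriangular m (minor M zero) (above ∘ ℕ.s<s) (diagonal ∘ suc)) ⟩
    1# * 1#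
      ≡⟨ *-identityˡ 1# ⟩
    1# ∎

  det-upper-unitriangular : ∀ m (M : Matrix m) → (∀ {r c} → c Fin.< r → M r c ≡ 0#) → (∀ r → M r r ≡ 1#) →
                            det ℝ m M ≡ 1#
  det-upper-unitriangular m M below diagonal =
    ≡.trans (≡.sym (det-transpose m M)) (det-lower-unitriangular m (transpose M) below diagonal)

  record IsLinear {N : ℕ} (F : (Fin N → Carrier) → Carrier) : Set where
    field
      congruent   : ∀ {u v} → (∀ s → u s ≡ v s) → F u ≡ F v
      additive    : ∀ u v → F (λ s → u s + v s) ≡ F u + F v
      homogeneous : ∀ x u → F (λ s → x * u s) ≡ x * F u

    0-homo : F (λ _ → 0#) ≡ 0#
    0-homo = begin
      F (λ _ → 0#)       ≡⟨ congruent (λ _ → ≡.sym (zeroˡ 0#)) ⟩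
      F (λ _ → 0# * 0#)  ≡⟨ homogeneous 0# (λ _ → 0#) ⟩
      0# * F (λ _ → 0#)  ≡⟨ zeroˡ _ ⟩
      0#                 ∎

    -‿homo : ∀ u → F (λ s → - u s) ≡ - F u
    -‿homo u = begin
      F (λ s → - u s)       ≡⟨ congruent (λ s → ≡.sym (-1*x≈-x (u s))) ⟩
      F (λ s → - 1# * u s)  ≡⟨ homogeneous (- 1#) u ⟩
      - 1# * F u            ≡⟨ -1*x≈-x (F u) ⟩
      - F u                 ∎

    Σ±-homo : ∀ {p} (g : Fin p → Carrier) (V : Fin p → Fin N → Carrier) →
              F (λ s → Σ± (λ r → g r * V r s)) ≡ Σ± (λ r → g r * F (V r))
    Σ±-homo {zero}  g V = 0-homo
    Σ±-homo {suc p} g V = begin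
      F (λ s → g zero * V zero s + - rest s)
        ≡⟨ additive (λ s → g zero * V zero s) (λ s → - rest s) ⟩
      F (λ s → g zero * V zero s) + F (λ s → - rest s)
        ≡⟨ cong₂ _+_ (homogeneous (g zero) (V zero)) (-‿homo rest) ⟩
      g zero * F (V zero) + - F rest
        ≡⟨ cong (λ t → g zero * F (V zero) + - t) (Σ±-homo (g ∘ suc) (V ∘ suc)) ⟩
      Σ± (λ r → g r * F (V r)) ∎
      where
      rest : Fin N → Carrier
      rest s = Σ± (λ r → g (suc r) * V (suc r) s)

  open IsLinear

  +-isLinear : ∀ {N} {F G : (Fin N → Carrier) → Carrier} → IsLinear F → IsLinear G → IsLinear (λ x → F x + G x)
  +-isLinear {F = F} {G} F-lin G-lin = record
    { congruent   = λ u≗v → cong₂ _+_ (congruent F-lin u≗v) (congruent G-lin u≗v)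
    ; additive    = λ u v → ≡.trans (cong₂ _+_ (additive F-lin u v) (additive G-lin u v))
                                      (+-interchange (F u) (F v) (G u) (G v))
    ; homogeneous = λ x u → ≡.trans (cong₂ _+_ (homogeneous F-lin x u) (homogeneous G-lin x u))
                                      (≡.sym (distribˡ x (F u) (G u)))
    }

  *-isLinear : ∀ {N} {F : (Fin N → Carrier) → Carrier} c → IsLinear F → IsLinear (λ x → c * F x)
  *-isLinear {F = F} c F-lin = record
    { congruent   = λ u≗v → cong (c *_) (congruent F-lin u≗v)
    ; additive    = λ u v → ≡.trans (cong (c *_) (additive F-lin u v)) (distribˡ c (F u) (F v))
    ; homogeneous = λ x u → ≡.trans (cong (c *_) (homogeneous F-lin x u)) (x*yz≡y*xz c x (F u))
    }

  ∘-isLinear : ∀ {N N′} {F : (Fin N → Carrier) → Carrier} → IsLinear F → (f : Fin N → Fin N′) →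
               IsLinear (λ (x : Fin N′ → Carrier) → F (x ∘ f))
  ∘-isLinear F-lin f = record
    { congruent   = λ u≗v → congruent F-lin (u≗v ∘ f)
    ; additive    = λ u v → additive F-lin (u ∘ f) (v ∘ f)
    ; homogeneous = λ x u → homogeneous F-lin x (u ∘ f)
    }

  det-head-isLinear : ∀ {m} (N : Fin m → Fin (suc m) → Carrier) → IsLinear (λ x → det ℝ (suc m) (x ∷ N))
  det-head-isLinear {m} N = record
    { congruent   = λ u≗v → Σ±-cong (λ j → cong (_* K j) (u≗v j))
    ; additive    = λ u v → ≡.trans (Σ±-cong (λ j → distribʳ (K j) (u j) (v j)))
                                    (Σ±-+ (λ j → u j * K j) (λ j → v j * K j))
    ; homogeneous = λ x u → ≡.trans (Σ±-cong (λ j → *-assoc x (u j) (K j)))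
                                    (≡.sym (*-distribˡ-Σ± x (λ j → u j * K j)))
    }
    where
    K : Fin (suc m) → Carrier
    K j = det ℝ m (λ r c → N r (punchIn j c))

  cramer : ∀ m (B : Matrix m) (y : Fin m → Carrier) s →
           y s * det ℝ m B ≡ Σ± (λ r → B r s * det ℝ m (removeAt (y ∷ B) (suc r)))
  cramer (suc m) B y s = x-y≡0⇒x≡y (begin
    y s * det ℝ (suc m) B + - Σ± (λ r → B r s * det ℝ (suc m) (removeAt (y ∷ B) (suc r)))
      ≡⟨ Σ±-cong (λ j → cong ((y ∷ B) j s *_) (det-transpose (suc m) (removeAt (y ∷ B) j))) ⟨
    det ℝ (suc (suc m)) N
      ≡⟨ det-equal-rows (suc m) s N (λ _ → ≡.refl) ⟩
    0# ∎)
    where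
    -- The rows of N are the columns of y ∷ B, with column s occurring as rows zero and suc s.
    N : Matrix (suc (suc m))
    N r c = (y ∷ B) c ((s ∷ id) r)

  punchIn-fromℕ : ∀ {m} (c : Fin m) → punchIn (fromℕ m) c ≡ inject₁ c
  punchIn-fromℕ zero    = ≡.refl
  punchIn-fromℕ (suc c) = cong suc (punchIn-fromℕ c)

  inject₁-or-fromℕ : ∀ {m} (s : Fin (suc m)) → (∃ λ s′ → s ≡ inject₁ s′) ⊎ s ≡ fromℕ m
  inject₁-or-fromℕ {zero}  zero    = inj₂ ≡.refl
  inject₁-or-fromℕ {suc m} zero    = inj₁ (zero , ≡.refl)
  inject₁-or-fromℕ {suc m} (suc s) with inject₁-or-fromℕ s
  ... | inj₁ (s′ , ≡.refl) = inj₁ (suc s′ , ≡.refl)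
  ... | inj₂ ≡.refl        = inj₂ ≡.refl

  inner : ∀ {m} → Matrix (suc (suc m)) → Matrix m
  inner M = map (init ∘ tail) (init (tail M))

  module DesnanotJacobi {m} (M : Matrix (suc (suc m))) where
    middleRows : Fin m → Fin (suc (suc m)) → Carrier
    middleRows = init (tail M)

    c₀ A C : Carrier
    c₀ = det ℝ m (inner M)
    A  = det ℝ (suc m) (map tail (tail M))
    C  = det ℝ (suc m) (map init (tail M))

    -- Φ (M zero) is the difference of the two sides of the identity.
    Φ : (Fin (suc (suc m)) → Carrier) → Carrier
    Φ x = c₀ * det ℝ (suc (suc m)) (x ∷ tail M)
        + (- A * det ℝ (suc m) (init x ∷ map init middleRows) + C * det ℝ (suc m) (tail x ∷ map tail middleRows))

    Φ-isLinear : IsLinear Φ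
    Φ-isLinear =
      +-isLinear (*-isLinear c₀ (det-head-isLinear (tail M)))
        (+-isLinear (*-isLinear (- A) (∘-isLinear (det-head-isLinear (map init middleRows)) inject₁))
                    (*-isLinear C (∘-isLinear (det-head-isLinear (map tail middleRows)) suc)))

    Φ-middleRows : ∀ r → Φ (middleRows r) ≡ 0#
    Φ-middleRows r = begin
      Φ (middleRows r)
        ≡⟨ cong₂ (λ p q → c₀ * p + q)
             (det-equal-rows (suc m) (inject₁ r) (middleRows r ∷ tail M) (λ _ → ≡.refl))
             (cong₂ (λ p q → - A * p + C * q)
               (det-equal-rows m r (init (middleRows r) ∷ map init middleRows) (λ _ → ≡.refl))
               (det-equal-rows m r (tail (middleRows r) ∷ map tail middleRows) (λ _ → ≡.refl))) ⟩
      c₀ * 0# + (- A * 0# + C * 0#)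
        ≡⟨ solve 3 (λ c₀ A C → c₀ :* con 0ℤ :+ (:- A :* con 0ℤ :+ C :* con 0ℤ) := con 0ℤ) ≡.refl c₀ A C ⟩
      0# ∎

    Φ-e-first : Φ e-first ≡ 0#
    Φ-e-first = begin
      Φ e-first
        ≡⟨ cong₂ (λ p q → c₀ * p + q)
             (Σ±-head (λ j → e-first j * det ℝ (suc m) (minor (e-first ∷ tail M) j)) (λ _ → zeroˡ _))
             (cong₂ (λ p q → - A * p + C * q)
               (Σ±-head (λ j → init e-first j * det ℝ m (minor (init e-first ∷ map init middleRows) j))
                        (λ _ → zeroˡ _))
               (0-homo (det-head-isLinear (map tail middleRows)))) ⟩
      c₀ * (1# * A) + (- A * (1# * c₀) + C * 0#)
        ≡⟨ solve 3 (λ c₀ A C → c₀ :* (con 1ℤ :* A) :+ (:- A :* (con 1ℤ :* c₀) :+ C :* con 0ℤ) := con 0ℤ)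
             ≡.refl c₀ A C ⟩
      0# ∎

    Φ-e-last : Φ e-last ≡ 0#
    Φ-e-last = begin
      Φ e-last
        ≡⟨ cong₂ (λ p q → c₀ * p + q)
             (≡.trans (Σ±-e-last (λ j → det ℝ (suc m) (minor (e-last ∷ tail M) j)))
                      (cong (Σ± (e-last {suc m}) *_)
                        (det-cong (suc m) (λ r c → cong (M (suc r)) (punchIn-fromℕ c)))))
             (cong₂ (λ p q → - A * p + C * q)
               (≡.trans (congruent (det-head-isLinear (map init middleRows)) e-last-inject₁)
                        (0-homo (det-head-isLinear (map init middleRows))))
               (≡.trans (Σ±-e-last (λ j → det ℝ m (minor (tail e-last ∷ map tail middleRows) j)))
                        (cong (σ *_)
                          (det-cong m (λ r c → cong (middleRows r ∘ suc) (punchIn-fromℕ c)))))) ⟩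
      c₀ * ((0# + - σ) * C) + (- A * 0# + C * (σ * c₀))
        ≡⟨ solve 4 (λ c₀ A C σ → c₀ :* ((con 0ℤ :+ :- σ) :* C) :+ (:- A :* con 0ℤ :+ C :* (σ :* c₀)) := con 0ℤ)
             ≡.refl c₀ A C σ ⟩
      0# ∎
      where
      σ : Carrier
      σ = Σ± (e-last {m})

    -- c₀ x is a combination of the middle rows (by Cramer) plus multiples of e-first and e-last.
    module Decomposition (x : Fin (suc (suc m)) → Carrier) where
      γ : Fin m → Carrier
      γ r = det ℝ m (removeAt (init (tail x) ∷ inner M) (suc r))

      v : Fin (suc (suc m)) → Carrier
      v s = Σ± (λ r → γ r * middleRows r s)

      α β : Carrier
      α = c₀ * x zero + - v zero
      β = c₀ * x (fromℕ (suc m)) + - v (fromℕ (suc m))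

      w : Fin (suc (suc m)) → Carrier
      w s = α * e-first s + β * e-last s

      decomposition : ∀ s → c₀ * x s ≡ v s + w s
      decomposition zero =
        solve 4 (λ c₀x v α β → c₀x := v :+ ((c₀x :+ :- v) :* con 1ℤ :+ β :* con 0ℤ)) ≡.refl
          (c₀ * x zero) (v zero) α β
      decomposition (suc s) with inject₁-or-fromℕ s
      ... | inj₁ (s′ , ≡.refl) = begin
        c₀ * x (suc (inject₁ s′))                  ≡⟨ *-comm c₀ _ ⟩
        init (tail x) s′ * c₀                      ≡⟨ cramer m (inner M) (init (tail x)) s′ ⟩
        Σ± (λ r → inner M r s′ * γ r)              ≡⟨ Σ±-cong (λ r → *-comm (inner M r s′) (γ r)) ⟩
        v S                                        ≡⟨ solve 3 (λ v α β → v := v :+ (α :* con 0ℤ :+ β :* con 0ℤ))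
                                                        ≡.refl (v S) α β ⟩
        v S + (α * 0# + β * 0#)                    ≡⟨ cong (λ e → v S + (α * 0# + β * e)) (e-last-inject₁ s′) ⟨
        v S + w S                                  ∎
        where
        S : Fin (suc (suc m))
        S = suc (inject₁ s′)
      ... | inj₂ ≡.refl = begin
        c₀ * x L                     ≡⟨ solve 3 (λ c₀x v α → c₀x := v :+ (α :* con 0ℤ :+ (c₀x :+ :- v) :* con 1ℤ))
                                          ≡.refl (c₀ * x L) (v L) α ⟩
        v L + (α * 0# + β * 1#)      ≡⟨ cong (λ e → v L + (α * 0# + β * e)) (e-last-fromℕ m) ⟨
        v L + w L                    ∎
        where
        L : Fin (suc (suc m))
        L = fromℕ (suc m)

    Φ-vanishes : c₀ ≢ 0# → ∀ x → Φ x ≡ 0#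
    Φ-vanishes c₀≢0 x = *-nonzero-cancelˡ c₀≢0 (begin
      c₀ * Φ x                  ≡⟨ homogeneous Φ-isLinear c₀ x ⟨
      Φ (λ s → c₀ * x s)        ≡⟨ congruent Φ-isLinear decomposition ⟩
      Φ (λ s → v s + w s)       ≡⟨ additive Φ-isLinear v w ⟩
      Φ v + Φ w                 ≡⟨ cong₂ _+_ Φ-v Φ-w ⟩
      0# + 0#                   ≡⟨ +-identityʳ 0# ⟩
      0#                        ∎)
      where
      open Decomposition x
      Φ-v : Φ v ≡ 0#
      Φ-v = ≡.trans (Σ±-homo Φ-isLinear γ middleRows)
                    (Σ±-zero (λ r → ≡.trans (cong (γ r *_) (Φ-middleRows r)) (zeroʳ (γ r))))
      Φ-w : Φ w ≡ 0#
      Φ-w = begin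
        Φ w                               ≡⟨ additive Φ-isLinear (λ s → α * e-first s) (λ s → β * e-last s) ⟩
        Φ (λ s → α * e-first s) + Φ (λ s → β * e-last s)
                                          ≡⟨ cong₂ _+_ (homogeneous Φ-isLinear α e-first)
                                                       (homogeneous Φ-isLinear β e-last) ⟩
        α * Φ e-first + β * Φ e-last      ≡⟨ cong₂ (λ p q → α * p + β * q) Φ-e-first Φ-e-last ⟩
        α * 0# + β * 0#                   ≡⟨ solve 2 (λ α β → α :* con 0ℤ :+ β :* con 0ℤ := con 0ℤ) ≡.refl α β ⟩
        0#                                ∎

  desnanot-jacobi : ∀ m (M : Matrix (suc (suc m))) → det ℝ m (inner M) ≢ 0# →
    det ℝ (suc (suc m)) M * det ℝ m (inner M) ≡
      det ℝ (suc m) (map tail (tail M)) * det ℝ (suc m) (map init (init M))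
      + - (det ℝ (suc m) (map init (tail M)) * det ℝ (suc m) (map tail (init M)))
  desnanot-jacobi m M c₀≢0 = begin
    p * c₀
      ≡⟨ solve 6 (λ p q r c₀ A C → p :* c₀ := (c₀ :* p :+ (:- A :* q :+ C :* r)) :+ (A :* q :+ :- (C :* r)))
           ≡.refl p q r c₀ A C ⟩
    Φ (M zero) + (A * q + - (C * r))  ≡⟨ cong (_+ (A * q + - (C * r))) (Φ-vanishes c₀≢0 (M zero)) ⟩
    0# + (A * q + - (C * r))      ≡⟨ +-identityˡ _ ⟩
    A * q + - (C * r)             ∎
    where
    open DesnanotJacobi M
    p q r : Carrier
    p = det ℝ (suc (suc m)) M
    q = det ℝ (suc m) (map init (init M))
    r = det ℝ (suc m) (map tail (init M))

≤-by-difference : ∀ {x y} p q → p ℕ.≤ q → x ℤ.- y ≡ + p ℤ.- + q → x ℤ.≤ y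
≤-by-difference p q p≤q x-y≡p-q =
  ℤ.i-j≤0⇒i≤j (subst (ℤ._≤ 0ℤ) (≡.sym x-y≡p-q) (ℤ.i≤j⇒i-j≤0 (ℤ.+≤+ p≤q)))

m+n≡o⇒n≤o : ∀ m {n o} → m ℕ.+ n ≡ o → n ℕ.≤ o
m+n≡o⇒n≤o m {n} m+n≡o = subst (n ℕ.≤_) m+n≡o (ℕ.m≤n+m n m)

≤-offset : ∀ {b j} m → b ℤ.≤ j → j ℤ.≤ b ℤ.+ + m → ∃ λ s → j ≡ b ℤ.+ + s × s ℕ.≤ m
≤-offset {b} {j} m b≤j j≤b+m = ℤ.∣ j ℤ.- b ∣ , j≡b+s , ℤ.drop‿+≤+ s≤m
  where
  split : ∀ b j → j ≡ b ℤ.+ (j ℤ.- b)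
  split = solve-∀
  cancel : ∀ b x → (b ℤ.+ x) ℤ.- b ≡ x
  cancel = solve-∀
  +s≡j-b : + ℤ.∣ j ℤ.- b ∣ ≡ j ℤ.- b
  +s≡j-b = ℤ.0≤i⇒+∣i∣≡i (ℤ.i≤j⇒0≤j-i b≤j)
  j≡b+s : j ≡ b ℤ.+ + ℤ.∣ j ℤ.- b ∣
  j≡b+s = ≡.trans (split b j) (cong (λ x → b ℤ.+ x) (≡.sym +s≡j-b))
  s≤m : + ℤ.∣ j ℤ.- b ∣ ℤ.≤ + m
  s≤m = subst₂ ℤ._≤_ (≡.sym +s≡j-b) (cancel b (+ m)) (ℤ.+-monoˡ-≤ (ℤ.- b) j≤b+m)

ℤ-induction : (P : ℤ → Set) → P (+ 0) → (∀ i → P i → P (i ℤ.+ + 1)) → (∀ i → P (i ℤ.+ + 1) → P i) →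
              ∀ i → P i
ℤ-induction P P₀ P-suc P-pred (+ zero)     = P₀
ℤ-induction P P₀ P-suc P-pred (+ suc n)    =
  subst P (cong +_ (ℕ.+-comm n 1)) (P-suc (+ n) (ℤ-induction P P₀ P-suc P-pred (+ n)))
ℤ-induction P P₀ P-suc P-pred -[1+ zero ]  = P-pred -[1+ 0 ] P₀
ℤ-induction P P₀ P-suc P-pred -[1+ suc n ] = P-pred -[1+ suc n ] (ℤ-induction P P₀ P-suc P-pred -[1+ n ])

module Minors (ℝ : RealNumbers) (a : ℤ → ℤ → RealNumbers.Carrier ℝ) where
  open RealNumbers ℝ
  open Determinants ℝ
  open ≡.≡-Reasoning

  D-cong : ∀ ℓ i j {f g : Fin ℓ → ℤ} → (∀ r → f r ≡ i ℤ.+ + toℕ r) → (∀ c → g c ≡ j ℤ.+ + toℕ c) →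
           det ℝ ℓ (λ r c → a (f r) (g c)) ≡ D ℝ a ℓ i j
  D-cong ℓ i j f≗ g≗ = det-cong ℓ (λ r c → cong₂ a (f≗ r) (g≗ c))

  offset-suc : ∀ i {ℓ} (r : Fin ℓ) → i ℤ.+ + toℕ (suc r) ≡ (i ℤ.+ + 1) ℤ.+ + toℕ r
  offset-suc i r = ≡.sym (ℤ.+-assoc i (+ 1) (+ toℕ r))

  offset-inject₁ : ∀ i {ℓ} (r : Fin ℓ) → i ℤ.+ + toℕ (inject₁ r) ≡ i ℤ.+ + toℕ r
  offset-inject₁ i r = cong (λ t → i ℤ.+ + t) (toℕ-inject₁ r)

  offset-inner : ∀ i {ℓ} (r : Fin ℓ) → i ℤ.+ + toℕ (suc (inject₁ r)) ≡ (i ℤ.+ + 1) ℤ.+ + toℕ r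
  offset-inner i r = ≡.trans (offset-suc i (inject₁ r)) (offset-inject₁ (i ℤ.+ + 1) r)

  D-desnanot-jacobi : ∀ m i j → D ℝ a m (i ℤ.+ + 1) (j ℤ.+ + 1) ≢ 0# →
    D ℝ a (suc (suc m)) i j * D ℝ a m (i ℤ.+ + 1) (j ℤ.+ + 1) ≡
      D ℝ a (suc m) (i ℤ.+ + 1) (j ℤ.+ + 1) * D ℝ a (suc m) i j
      + - (D ℝ a (suc m) (i ℤ.+ + 1) j * D ℝ a (suc m) i (j ℤ.+ + 1))
  D-desnanot-jacobi m i j c≢0 = begin
    det ℝ (suc (suc m)) M * D ℝ a m (i ℤ.+ + 1) (j ℤ.+ + 1)
      ≡⟨ cong (det ℝ (suc (suc m)) M *_) central ⟨
    det ℝ (suc (suc m)) M * det ℝ m (inner M)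
      ≡⟨ desnanot-jacobi m M (c≢0 ∘ ≡.trans (≡.sym central)) ⟩
    det ℝ (suc m) (map tail (tail M)) * det ℝ (suc m) (map init (init M))
      + - (det ℝ (suc m) (map init (tail M)) * det ℝ (suc m) (map tail (init M)))
      ≡⟨ cong₂ (λ x y → x + - y)
           (cong₂ _*_ (D-cong (suc m) (i ℤ.+ + 1) (j ℤ.+ + 1) (offset-suc i) (offset-suc j))
                      (D-cong (suc m) i j (offset-inject₁ i) (offset-inject₁ j)))
           (cong₂ _*_ (D-cong (suc m) (i ℤ.+ + 1) j (offset-suc i) (offset-inject₁ j))
                      (D-cong (suc m) i (j ℤ.+ + 1) (offset-inject₁ i) (offset-suc j))) ⟩
    D ℝ a (suc m) (i ℤ.+ + 1) (j ℤ.+ + 1) * D ℝ a (suc m) i j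
      + - (D ℝ a (suc m) (i ℤ.+ + 1) j * D ℝ a (suc m) i (j ℤ.+ + 1)) ∎
    where
    M : Matrix (suc (suc m))
    M r c = a (i ℤ.+ + toℕ r) (j ℤ.+ + toℕ c)
    central : det ℝ m (inner M) ≡ D ℝ a m (i ℤ.+ + 1) (j ℤ.+ + 1)
    central = D-cong m (i ℤ.+ + 1) (j ℤ.+ + 1) (offset-inner i) (offset-inner j)

module FriezeRows (ℝ : RealNumbers) {k n : ℕ} {a : ℤ → ℤ → RealNumbers.Carrier ℝ} (F : IsFrieze ℝ k n a) where
  open RealNumbers ℝ hiding (_≤_)
  open OrderedField ℝ
  open Determinants ℝ
  open Minors ℝ a
  open IsFrieze F
  open ≡.≡-Reasoning

  left-zero : ∀ b {r c} → c ℕ.< r → r ℕ.< k → a (b ℤ.+ + suc r) (b ℤ.+ + c) ≡ 0#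
  left-zero b {r} {c} c<r r<k = zeros-left _ _
    (≤-by-difference (suc r) (k ℕ.+ c) (ℕ.≤-trans r<k (ℕ.m≤m+n k c)) (lower b (+ suc r) (+ k) (+ c)))
    (≤-by-difference (suc (suc c)) (suc r) (ℕ.s≤s c<r) (upper b (+ suc r) (+ 2) (+ c)))
    where
    lower : ∀ b x y z → ((b ℤ.+ x) ℤ.- y) ℤ.- (b ℤ.+ z) ≡ x ℤ.- (y ℤ.+ z)
    lower = solve-∀
    upper : ∀ b x y z → (b ℤ.+ z) ℤ.- ((b ℤ.+ x) ℤ.- y) ≡ (y ℤ.+ z) ℤ.- x
    upper = solve-∀

  left-one : ∀ b c → a (b ℤ.+ + suc c) (b ℤ.+ + c) ≡ 1#
  left-one b c = subst (λ j → a (b ℤ.+ + suc c) j ≡ 1#) (shift b (+ c)) (ones-left (b ℤ.+ + suc c))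
    where
    shift : ∀ b x → (b ℤ.+ (+ 1 ℤ.+ x)) ℤ.- + 1 ≡ b ℤ.+ x
    shift = solve-∀

  right-zero : ∀ i {r c} → r ℕ.< c → c ℕ.< k → a (i ℤ.+ + r) (i ℤ.+ + (n ℕ.+ c)) ≡ 0#
  right-zero i {r} {c} r<c c<k = zeros-right _ _
    (≤-by-difference (suc r) c r<c (lower i (+ r) (+ n) (+ c)))
    (≤-by-difference (suc c) (k ℕ.+ r) (ℕ.≤-trans c<k (ℕ.m≤m+n k r)) (upper i (+ r) (+ n) (+ c) (+ k)))
    where
    lower : ∀ i x y z → (((i ℤ.+ x) ℤ.+ y) ℤ.+ + 1) ℤ.- (i ℤ.+ (y ℤ.+ z)) ≡ (+ 1 ℤ.+ x) ℤ.- z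
    lower = solve-∀
    upper : ∀ i x y z w → (i ℤ.+ (y ℤ.+ z)) ℤ.- ((((i ℤ.+ x) ℤ.+ y) ℤ.+ w) ℤ.- + 1) ≡ (+ 1 ℤ.+ z) ℤ.- (w ℤ.+ x)
    upper = solve-∀

  right-one : ∀ i r → a (i ℤ.+ + r) (i ℤ.+ + (n ℕ.+ r)) ≡ 1#
  right-one i r = subst (λ j → a (i ℤ.+ + r) j ≡ 1#) (shift i (+ r) (+ n)) (ones-right (i ℤ.+ + r))
    where
    shift : ∀ i x y → (i ℤ.+ x) ℤ.+ y ≡ i ℤ.+ (y ℤ.+ x)
    shift = solve-∀

  -- Columns are counted from i - 1, so that the range i - 1 ≤ j ≤ i + n of det-one becomes 0 ≤ s ≤ n + 1.
  Γ : ℕ → ℤ → ℕ → Carrier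
  Γ ℓ i s = D ℝ a ℓ i ((i ℤ.- + 1) ℤ.+ + s)

  Γ-left : ∀ ℓ i → ℓ ≤ k → Γ ℓ i 0 ≡ 1#
  Γ-left ℓ i ℓ≤k = ≡.trans (det-cong ℓ (λ r c → cong₂ a (row i (+ toℕ r)) (column i (+ toℕ c))))
    (det-upper-unitriangular ℓ _ (λ {r} c<r → left-zero (i ℤ.- + 1) c<r (ℕ.<-≤-trans (toℕ<n r) ℓ≤k))
                                 (λ r → left-one (i ℤ.- + 1) (toℕ r)))
    where
    row : ∀ i x → i ℤ.+ x ≡ (i ℤ.- + 1) ℤ.+ (+ 1 ℤ.+ x)
    row = solve-∀
    column : ∀ i x → ((i ℤ.- + 1) ℤ.+ + 0) ℤ.+ x ≡ (i ℤ.- + 1) ℤ.+ x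
    column = solve-∀

  Γ-right : ∀ ℓ i → ℓ ≤ k → Γ ℓ i (suc n) ≡ 1#
  Γ-right ℓ i ℓ≤k = ≡.trans (det-cong ℓ (λ r c → cong (a (i ℤ.+ + toℕ r)) (column i (+ n) (+ toℕ c))))
    (det-lower-unitriangular ℓ _ (λ {_} {c} r<c → right-zero i r<c (ℕ.<-≤-trans (toℕ<n c) ℓ≤k))
                                 (λ r → right-one i (toℕ r)))
    where
    column : ∀ i y x → ((i ℤ.- + 1) ℤ.+ (+ 1 ℤ.+ y)) ℤ.+ x ≡ i ℤ.+ (y ℤ.+ x)
    column = solve-∀

  Γ-top : ∀ i s → s ≤ suc n → Γ k i s ≡ 1#
  Γ-top i s s≤1+n = det-one i ((i ℤ.- + 1) ℤ.+ + s) (ℤ.i≤i+j (i ℤ.- + 1) (+ s))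
    (≤-by-difference s (suc n) s≤1+n (difference i (+ s) (+ n)))
    where
    difference : ∀ i x y → ((i ℤ.- + 1) ℤ.+ x) ℤ.- (i ℤ.+ y) ≡ x ℤ.- (+ 1 ℤ.+ y)
    difference = solve-∀

  Γ-condensation : ∀ l i s → Γ l (i ℤ.+ + 1) (suc s) ≢ 0# →
    Γ (suc l) (i ℤ.+ + 1) (suc s) * Γ (suc l) i (suc s) ≡
      Γ (suc (suc l)) i (suc s) * Γ l (i ℤ.+ + 1) (suc s) + Γ (suc l) (i ℤ.+ + 1) s * Γ (suc l) i (suc (suc s))
  Γ-condensation l i s c≢0 = begin
    Γ (suc l) i′ (suc s) * Γ (suc l) i (suc s)
      ≡⟨ cong (λ x → D ℝ a (suc l) i′ x * Γ (suc l) i (suc s)) j+1≡ ⟨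
    D ℝ a (suc l) i′ (j ℤ.+ + 1) * D ℝ a (suc l) i j
      ≡⟨ x≡y-z⇒y≡x+z (D-desnanot-jacobi l i j (c≢0 ∘ ≡.trans (cong (D ℝ a l i′) (≡.sym j+1≡)))) ⟩
    D ℝ a (suc (suc l)) i j * D ℝ a l i′ (j ℤ.+ + 1) + D ℝ a (suc l) i′ j * D ℝ a (suc l) i (j ℤ.+ + 1)
      ≡⟨ cong₂ (λ x y → Γ (suc (suc l)) i (suc s) * x + y) (cong (D ℝ a l i′) j+1≡)
           (cong₂ _*_ (cong (D ℝ a (suc l) i′) (j≡ i (+ s))) (cong (D ℝ a (suc l) i) (j+1≡′ i (+ suc s)))) ⟩
    Γ (suc (suc l)) i (suc s) * Γ l i′ (suc s) + Γ (suc l) i′ s * Γ (suc l) i (suc (suc s)) ∎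
    where
    i′ j : ℤ
    i′ = i ℤ.+ + 1
    j  = (i ℤ.- + 1) ℤ.+ + suc s
    shift : ∀ i x → ((i ℤ.- + 1) ℤ.+ x) ℤ.+ + 1 ≡ ((i ℤ.+ + 1) ℤ.- + 1) ℤ.+ x
    shift = solve-∀
    j+1≡ : j ℤ.+ + 1 ≡ (i′ ℤ.- + 1) ℤ.+ + suc s
    j+1≡ = shift i (+ suc s)
    j≡ : ∀ i x → (i ℤ.- + 1) ℤ.+ (+ 1 ℤ.+ x) ≡ ((i ℤ.+ + 1) ℤ.- + 1) ℤ.+ x
    j≡ = solve-∀
    j+1≡′ : ∀ i x → ((i ℤ.- + 1) ℤ.+ x) ℤ.+ + 1 ≡ (i ℤ.- + 1) ℤ.+ (+ 1 ℤ.+ x)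
    j+1≡′ = solve-∀

  condensation-positive : ∀ l i s →
    0# < Γ l (i ℤ.+ + 1) (suc s) → 0# < Γ (suc (suc l)) i (suc s) →
    0# < Γ (suc l) (i ℤ.+ + 1) s → 0# < Γ (suc l) i (suc (suc s)) →
    0# < Γ (suc l) (i ℤ.+ + 1) (suc s) * Γ (suc l) i (suc s)
  condensation-positive l i s 0<c 0<p 0<q 0<r =
    subst (0# <_) (≡.sym (Γ-condensation l i s (positive⇒≢0 0<c))) (+-positive (*-pos 0<p 0<c) (*-pos 0<q 0<r))

  RowPositive : ℤ → Set
  RowPositive i = ∀ ℓ s → ℓ ≤ k → s ≤ suc n → 0# < Γ ℓ i s

  top-positive : ∀ {ℓ} i s → ℓ ≡ k → s ≤ suc n → 0# < Γ ℓ i s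
  top-positive i s ℓ≡k s≤1+n = subst (λ ℓ → 0# < Γ ℓ i s) (≡.sym ℓ≡k) (≡1⇒positive (Γ-top i s s≤1+n))

  right-positive : ∀ {s} ℓ i → ℓ ≤ k → s ≡ suc n → 0# < Γ ℓ i s
  right-positive ℓ i ℓ≤k s≡1+n = subst (λ s → 0# < Γ ℓ i s) (≡.sym s≡1+n) (≡1⇒positive (Γ-right ℓ i ℓ≤k))

  RowPositive-down : ∀ i → RowPositive i → RowPositive (i ℤ.+ + 1)
  RowPositive-down i above ℓ s ℓ≤k s≤1+n = go (k ∸ ℓ) (suc n ∸ s) ℓ s (ℕ.m∸n+n≡m ℓ≤k) (ℕ.m∸n+n≡m s≤1+n)
    where
    go : ∀ d e ℓ s → d ℕ.+ ℓ ≡ k → e ℕ.+ s ≡ suc n → 0# < Γ ℓ (i ℤ.+ + 1) s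
    go _       _       zero    _       _   _   = 0<1
    go d       _       (suc l) zero    d+ℓ _   = ≡1⇒positive (Γ-left (suc l) (i ℤ.+ + 1) (m+n≡o⇒n≤o d d+ℓ))
    go zero    e       (suc l) (suc s) ℓ≡k e+s = top-positive (i ℤ.+ + 1) (suc s) ℓ≡k (m+n≡o⇒n≤o e e+s)
    go (suc d) zero    (suc l) (suc s) d+ℓ s≡  = right-positive (suc l) (i ℤ.+ + 1) (m+n≡o⇒n≤o (suc d) d+ℓ) s≡
    go (suc d) (suc e) (suc l) (suc s) d+ℓ e+s =
      *-positive-cancelʳ (above (suc l) (suc s) (m+n≡o⇒n≤o (suc d) d+ℓ) (m+n≡o⇒n≤o (suc e) e+s))
        (condensation-positive l i s
          (go (suc (suc d)) (suc e) l (suc s) (≡.trans (≡.sym (ℕ.+-suc (suc d) l)) d+ℓ) e+s)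
          (above (suc (suc l)) (suc s) (m+n≡o⇒n≤o d (≡.trans (ℕ.+-suc d (suc l)) d+ℓ)) (m+n≡o⇒n≤o (suc e) e+s))
          (go (suc d) (suc (suc e)) (suc l) s d+ℓ (≡.trans (≡.sym (ℕ.+-suc (suc e) s)) e+s))
          (above (suc l) (suc (suc s)) (m+n≡o⇒n≤o (suc d) d+ℓ) (m+n≡o⇒n≤o e (≡.trans (ℕ.+-suc e (suc s)) e+s))))

  RowPositive-up : ∀ i → RowPositive (i ℤ.+ + 1) → RowPositive i
  RowPositive-up i below ℓ s ℓ≤k s≤1+n = go (k ∸ ℓ) (suc n ∸ s) ℓ s (ℕ.m∸n+n≡m ℓ≤k) (ℕ.m∸n+n≡m s≤1+n)
    where
    go : ∀ d e ℓ s → d ℕ.+ ℓ ≡ k → e ℕ.+ s ≡ suc n → 0# < Γ ℓ i s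
    go _       _       zero    _       _   _   = 0<1
    go d       _       (suc l) zero    d+ℓ _   = ≡1⇒positive (Γ-left (suc l) i (m+n≡o⇒n≤o d d+ℓ))
    go zero    e       (suc l) (suc s) ℓ≡k e+s = top-positive i (suc s) ℓ≡k (m+n≡o⇒n≤o e e+s)
    go (suc d) zero    (suc l) (suc s) d+ℓ s≡  = right-positive (suc l) i (m+n≡o⇒n≤o (suc d) d+ℓ) s≡
    go (suc d) (suc e) (suc l) (suc s) d+ℓ e+s =
      *-positive-cancelˡ (below (suc l) (suc s) (m+n≡o⇒n≤o (suc d) d+ℓ) (m+n≡o⇒n≤o (suc e) e+s))
        (condensation-positive l i s
          (below l (suc s) (m+n≡o⇒n≤o (suc (suc d)) (≡.trans (≡.sym (ℕ.+-suc (suc d) l)) d+ℓ)) (m+n≡o⇒n≤o (suc e) e+s))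
          (go d (suc e) (suc (suc l)) (suc s) (≡.trans (ℕ.+-suc d (suc l)) d+ℓ) e+s)
          (below (suc l) s (m+n≡o⇒n≤o (suc d) d+ℓ) (m+n≡o⇒n≤o (suc (suc e)) (≡.trans (≡.sym (ℕ.+-suc (suc e) s)) e+s)))
          (go (suc d) e (suc l) (suc (suc s)) d+ℓ (≡.trans (ℕ.+-suc e (suc s)) e+s)))

  RowPositive-everywhere : RowPositive (+ 1) → ∀ i → RowPositive i
  RowPositive-everywhere row₁ = ℤ-induction RowPositive (RowPositive-up (+ 0) row₁) RowPositive-down RowPositive-up

  first-row-positive : (∀ (ℓ : ℕ) j → 1 ≤ ℓ → ℓ ≤ k ∸ 1 → + 1 ℤ.≤ j → j ℤ.≤ + n → 0# < D ℝ a ℓ (+ 1) j) →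
                       RowPositive (+ 1)
  first-row-positive interior ℓ s ℓ≤k s≤1+n = go (k ∸ ℓ) (suc n ∸ s) ℓ s (ℕ.m∸n+n≡m ℓ≤k) (ℕ.m∸n+n≡m s≤1+n)
    where
    go : ∀ d e ℓ s → d ℕ.+ ℓ ≡ k → e ℕ.+ s ≡ suc n → 0# < Γ ℓ (+ 1) s
    go _       _       zero    _       _   _   = 0<1
    go d       _       (suc l) zero    d+ℓ _   = ≡1⇒positive (Γ-left (suc l) (+ 1) (m+n≡o⇒n≤o d d+ℓ))
    go zero    e       (suc l) (suc s) ℓ≡k e+s = top-positive (+ 1) (suc s) ℓ≡k (m+n≡o⇒n≤o e e+s)
    go (suc d) zero    (suc l) (suc s) d+ℓ s≡  = right-positive (suc l) (+ 1) (m+n≡o⇒n≤o (suc d) d+ℓ) s≡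
    go (suc d) (suc e) (suc l) (suc s) d+ℓ e+s =
      interior (suc l) (+ suc s) (ℕ.s≤s ℕ.z≤n)
        (ℕ.∸-monoˡ-≤ 1 (m+n≡o⇒n≤o d (≡.trans (ℕ.+-suc d (suc l)) d+ℓ)))
        (ℤ.+≤+ (ℕ.s≤s ℕ.z≤n))
        (ℤ.+≤+ (ℕ.s≤s⁻¹ (m+n≡o⇒n≤o e (≡.trans (ℕ.+-suc e (suc s)) e+s))))

  RowPositive⇒generic : (∀ i → RowPositive i) → IsGeneric ℝ k n a
  RowPositive⇒generic positive i j i≤j j≤i+n-1 with ≤-offset (suc n) i-1≤j j≤i-1+[1+n]
    where
    i-1≤j : i ℤ.- + 1 ℤ.≤ j
    i-1≤j = ℤ.≤-trans (ℤ.i-j≤i i (+ 1)) i≤j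
    shift : ∀ i y → i ℤ.+ y ≡ (i ℤ.- + 1) ℤ.+ (+ 1 ℤ.+ y)
    shift = solve-∀
    j≤i-1+[1+n] : j ℤ.≤ (i ℤ.- + 1) ℤ.+ + suc n
    j≤i-1+[1+n] = ℤ.≤-trans j≤i+n-1 (subst (i ℤ.+ + n ℤ.- + 1 ℤ.≤_) (shift i (+ n)) (ℤ.i-j≤i (i ℤ.+ + n) (+ 1)))
  ... | s , ≡.refl , s≤1+n = positive⇒≢0 (positive i (k ∸ 1) s (ℕ.m∸n≤m k 1) s≤1+n)

lemma2p8 : (ℝ : RealNumbers) → (k n : ℕ) → 2 ≤ k → 1 ≤ n →
    (a : ℤ → ℤ → RealNumbers.Carrier ℝ) → IsFrieze ℝ k n a →
    (∀ (ℓ : ℕ) j → 1 ≤ ℓ → ℓ ≤ k ∸ 1 → + 1 ≤ℤ j → j ≤ℤ + n →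
      RealNumbers._<_ ℝ (RealNumbers.0# ℝ) (D ℝ a ℓ (+ 1) j)) →
    IsGeneric ℝ k n a
lemma2p8 ℝ k n _ _ a F first-row = RowPositive⇒generic (RowPositive-everywhere (first-row-positive first-row))
  where open FriezeRows ℝ F
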